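{- Fix an integer $b>4$ and let $T$ be a relaxed B-slack tree with maximum degree $b$. If $T$ is not a B-slack tree, then at least one of the following holds (i.e., some rebalancing step can be performed): (Root-Replace) the root has exactly one child; (Root-Zero) the root has weight zero and does not have exactly one child; (Absorb or Split) some non-root node $u$ has weight zero (Absorb if $\pi(u)$ has fewer than $b$ pointers, Split if it has exactly $b$); (One-Child) some internal node $u$ has exactly one child, no weight violation occurs at $u$ or any sibling of $u$, and $\pi(u)$ has no weight, slack or degree violation; (Compress) some internal node $u$ has a slack violation, has no degree violation, and no weight violation occurs at $u$ or at any of its children.
   Context: Trees are leaf-oriented search trees: keys stored in leaves; internal nodes hold child pointers and routing keys. The degree of an internal node is its number of non-nil child pointers; the degree of a leaf is its number of keys; a node of degree $b-x$ contains $x$ units of slack. Each node carries a weight in $\{0,1\}$; the relaxed depth of a node is one less than the sum of weights of the nodes on the path from the root to it (inclusive). A relaxed B-slack tree satisfies: every node of weight zero has exactly two child pointers; all leaves have the same relaxed depth; internal nodes have between $1$ and $b$ child pointers; leaves have between $0$ and $b$ keys. A weight violation is a node of weight zero; a degree violation is an internal node with exactly one child; a slack violation is an internal node whose children contain a total of at least $b$ slack. A B-slack tree is a relaxed B-slack tree containing no violations (so all weights are one, all leaves have the same depth, internal nodes have $2$ to $b$ pointers, leaves have $0$ to $b$ keys, and the children of each internal node contain total slack at most $b-1$). $\pi(u)$ denotes the parent of $u$. -}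

module Defs where

open import Data.Nat using (ℕ; zero; suc; _+_; _∸_; _≤_; _<_; _≥_)
open import Data.Fin using (Fin; toℕ)
open import Data.List using (List; []; _∷_; length; lookup; map)
open import Data.Nat.ListAction using (sum)
open import Data.Product using (Σ; _×_; _,_; ∃)
open import Data.Sum using (_⊎_)
open import Data.Empty using (⊥)
open import Data.Unit using (⊤)
open import Relation.Nullary using (¬_)
open import Relation.Binary.PropositionalEquality using (_≡_; _≢_)

Weight : Set
Weight = Fin 2

-- Leaf-oriented search tree over a key type K.
-- leaf w ks     : a leaf of weight w storing the keys ks
-- node w rks cs : an internal node of weight w with routing keys rks and
--                 the list cs of its (non-nil) children
data Tree (K : Set) : Set where
  leaf : Weight → List K → Tree K
  node : Weight → List K → List (Tree K) → Tree K

module _ {K : Set} where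

  weight : Tree K → Weight
  weight (leaf w _)   = w
  weight (node w _ _) = w

  children : Tree K → List (Tree K)
  children (leaf _ _)    = []
  children (node _ _ cs) = cs

  degree : Tree K → ℕ
  degree (leaf _ ks)   = length ks
  degree (node _ _ cs) = length cs

  IsLeaf : Tree K → Set
  IsLeaf (leaf _ _)   = ⊤
  IsLeaf (node _ _ _) = ⊥

  IsInternal : Tree K → Set
  IsInternal (leaf _ _)   = ⊥
  IsInternal (node _ _ _) = ⊤

  data Pos : Tree K → Set where
    here : ∀ {t} → Pos t
    down : ∀ {w rks cs} (i : Fin (length cs)) → Pos (lookup cs i) → Pos (node w rks cs)

  at : ∀ {t} → Pos t → Tree K
  at {t} here     = t
  at (down i p)   = at p

  pathWeight : ∀ {t} → Pos t → ℕ
  pathWeight {t} here                = toℕ (weight t)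
  pathWeight {node w _ _} (down i p) = toℕ w + pathWeight p

  relaxedDepth : ∀ {t} → Pos t → ℕ
  relaxedDepth p = pathWeight p ∸ 1

module _ (b : ℕ) {K : Set} where

  slack : Tree K → ℕ
  slack t = b ∸ degree t

  WeightViol : Tree K → Set
  WeightViol t = weight t ≡ Fin.zero

  DegViol : Tree K → Set
  DegViol t = IsInternal t × length (children t) ≡ 1

  SlackViol : Tree K → Set
  SlackViol t = IsInternal t × sum (map slack (children t)) ≥ b

  record RelaxedBSlack (T : Tree K) : Set where
    field
      weight0⇒twoPointers : (p : Pos T) → WeightViol (at p) → length (children (at p)) ≡ 2
      leavesSameDepth     : (p q : Pos T) → IsLeaf (at p) → IsLeaf (at q) →
                            relaxedDepth p ≡ relaxedDepth q
      internalPointers    : (p : Pos T) → IsInternal (at p) →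
                            1 ≤ length (children (at p)) × length (children (at p)) ≤ b
      leafKeys            : (p : Pos T) → IsLeaf (at p) → degree (at p) ≤ b

  BSlack : Tree K → Set
  BSlack T = RelaxedBSlack T ×
             ((p : Pos T) → ¬ WeightViol (at p) × ¬ DegViol (at p) × ¬ SlackViol (at p))

  childAt : ∀ {T : Tree K} (p : Pos T) → Fin (length (children (at p))) → Tree K
  childAt p i = lookup (children (at p)) i

  RootReplace : Tree K → Set
  RootReplace T = DegViol T

  RootZero : Tree K → Set
  RootZero T = WeightViol T × length (children T) ≢ 1

  AbsorbOrSplit : Tree K → Set
  AbsorbOrSplit T =
    Σ (Pos T) λ p → Σ (Fin (length (children (at p)))) λ i →
      WeightViol (childAt p i) ×
      (length (children (at p)) < b ⊎ length (children (at p)) ≡ b)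

  OneChild : Tree K → Set
  OneChild T =
    Σ (Pos T) λ p → Σ (Fin (length (children (at p)))) λ i →
      DegViol (childAt p i) ×
      ¬ WeightViol (childAt p i) ×
      ((j : Fin (length (children (at p)))) → j ≢ i → ¬ WeightViol (childAt p j)) ×
      ¬ WeightViol (at p) × ¬ SlackViol (at p) × ¬ DegViol (at p)

  Compress : Tree K → Set
  Compress T =
    Σ (Pos T) λ p →
      SlackViol (at p) × ¬ DegViol (at p) × ¬ WeightViol (at p) ×
      ((j : Fin (length (children (at p)))) → ¬ WeightViol (childAt p j))

-- A weight violation below the root
-- always admits Absorb or Split, since its parent has at most b pointers. Failing
-- that, the root is handled by Root-Replace or Root-Zero, and otherwise no node has
-- weight zero at all. A slack violation at a node without a degree violation is then
-- a Compress. Otherwise a degree violation whose parent has none is a One-Child; if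
-- there is none either, the absence of degree violations at the root is inherited all
-- the way down, so there are no degree and hence no slack violations: T is B-slack.
module Submission where

open import Defs
open import Data.Nat using (ℕ; _>_; _≤_; _≟_; _≤?_)
open import Data.Nat.Properties using (m≤n⇒m<n∨m≡n)
open import Data.Nat.ListAction using (sum)
open import Data.Fin using (Fin; zero; suc)
import Data.Fin as Fin
open import Data.Fin.Properties using (any?)
open import Data.List using (List; []; _∷_; length; lookup; map)
open import Data.Product using (∃; _×_; _,_; proj₁; proj₂)
open import Data.Sum using (_⊎_; inj₁; inj₂)
open import Data.Unit using (tt)
open import Data.Empty using (⊥-elim)
open import Function using (_∘_)
open import Relation.Nullary using (¬_; Dec; yes; no)
open import Relation.Nullary.Decidable using (_×-dec_; _⊎-dec_; ¬?; map′)
open import Relation.Binary.PropositionalEquality using (_≡_)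

module _ {K : Set} where

  mutual
    any-Pos? : ∀ {t : Tree K} {P : Pos t → Set} → (∀ p → Dec (P p)) → Dec (∃ P)
    any-Pos? {leaf _ _} P? = map′ (here ,_) (λ { (here , x) → x }) (P? here)
    any-Pos? {node _ _ cs} P? =
      map′ (λ { (inj₁ x) → here , x ; (inj₂ (i , q , x)) → down i q , x })
           (λ { (here , x) → inj₁ x ; (down i q , x) → inj₂ (i , q , x) })
           (P? here ⊎-dec any-childPos? cs (λ i → P? ∘ down i))

    any-childPos? : (cs : List (Tree K)) {P : (i : Fin (length cs)) → Pos (lookup cs i) → Set} →
                    (∀ i q → Dec (P i q)) → Dec (∃ λ i → ∃ (P i))
    any-childPos? [] P? = no λ ()
    any-childPos? (c ∷ cs) P? =
      map′ (λ { (inj₁ (q , x)) → zero , q , x ; (inj₂ (i , q , x)) → suc i , q , x })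
           (λ { (zero , q , x) → inj₁ (q , x) ; (suc i , q , x) → inj₂ (i , q , x) })
           (any-Pos? {c} (P? zero) ⊎-dec any-childPos? cs (P? ∘ suc))

  at-hereditary : ∀ {t : Tree K} {P : Tree K → Set} → P t →
                  (∀ (p : Pos t) i → P (at p) → P (lookup (children (at p)) i)) →
                  (q : Pos t) → P (at q)
  at-hereditary         Pt step here       = Pt
  at-hereditary {P = P} Pt step (down i q) = at-hereditary {P = P} (step here i Pt) (λ p → step (down i p)) q

  child⇒IsInternal : ∀ {t : Tree K} → Fin (length (children t)) → IsInternal t
  child⇒IsInternal {node _ _ _} _ = tt

module _ (b : ℕ) {K : Set} where

  weightViol? : (t : Tree K) → Dec (WeightViol b t)
  weightViol? t = weight t Fin.≟ zero

  degViol? : (t : Tree K) → Dec (DegViol b t)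
  degViol? (leaf _ _)    = no proj₁
  degViol? (node _ _ cs) = map′ (tt ,_) proj₂ (length cs ≟ 1)

  slackViol? : (t : Tree K) → Dec (SlackViol b t)
  slackViol? (leaf _ _)    = no proj₁
  slackViol? (node _ _ cs) = map′ (tt ,_) proj₂ (b ≤? sum (map (slack b) cs))

  oneChild⇒DegViol : (t : Tree K) → length (children t) ≡ 1 → DegViol b t
  oneChild⇒DegViol (node _ _ _) one = tt , one

  oneChildOrCompress : ∀ {T : Tree K} → RelaxedBSlack b T → ¬ BSlack b T →
                       (∀ (q : Pos T) → ¬ WeightViol b (at q)) →
                       (∀ (p : Pos T) i → ¬ WeightViol b (childAt b p i)) →
                       ¬ DegViol b T → OneChild b T ⊎ Compress b T
  oneChildOrCompress {T} rb ¬bs ¬wv ¬childWV ¬dvT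
    with any-Pos? (λ p → slackViol? (at p) ×-dec ¬? (degViol? (at p)))
  ... | yes (p , sv , ¬dv) = inj₂ (p , sv , ¬dv , ¬wv p , ¬childWV p)
  ... | no ¬compress
    with any-Pos? (λ p → ¬? (degViol? (at p)) ×-dec any? (degViol? ∘ childAt b p))
  ... | yes (p , ¬dv , i , dv) =
    inj₁ (p , i , dv , ¬childWV p i , (λ j _ → ¬childWV p j) ,
          ¬wv p , (λ sv → ¬compress (p , sv , ¬dv)) , ¬dv)
  ... | no ¬oneChild = ⊥-elim (¬bs (rb , λ q → ¬wv q , ¬dv q , λ sv → ¬compress (q , sv , ¬dv q)))
    where
    ¬dv : ∀ (q : Pos T) → ¬ DegViol b (at q)
    ¬dv = at-hereditary {P = ¬_ ∘ DegViol b} ¬dvT (λ p i ¬dvp dv → ¬oneChild (p , ¬dvp , i , dv))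

lemma1 : (b : ℕ) → b > 4 → {K : Set} → (T : Tree K) →
         RelaxedBSlack b T → ¬ BSlack b T →
         RootReplace b T ⊎ RootZero b T ⊎ AbsorbOrSplit b T ⊎ OneChild b T ⊎ Compress b T
lemma1 b _ T rb ¬bs with any-Pos? (λ p → any? (weightViol? b ∘ childAt b p))
... | yes (p , i , wv) = inj₂ (inj₂ (inj₁ (p , i , wv , m≤n⇒m<n∨m≡n pointers≤b)))
  where
  pointers≤b : length (children (at p)) ≤ b
  pointers≤b = proj₂ (RelaxedBSlack.internalPointers rb p (child⇒IsInternal i))
... | no ¬childWV′ with degViol? b T
... | yes dv = inj₁ dv
... | no ¬dv with weightViol? b T
... | yes wv = inj₂ (inj₁ (wv , ¬dv ∘ oneChild⇒DegViol b T))
... | no ¬wv = inj₂ (inj₂ (inj₂ (oneChildOrCompress b rb ¬bs ¬wvAt ¬childWV ¬dv)))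
  where
  ¬childWV : ∀ (p : Pos T) i → ¬ WeightViol b (childAt b p i)
  ¬childWV p i wv = ¬childWV′ (p , i , wv)
  ¬wvAt : ∀ (q : Pos T) → ¬ WeightViol b (at q)
  ¬wvAt = at-hereditary {P = ¬_ ∘ WeightViol b} ¬wv (λ p i _ → ¬childWV p i)
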